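{- Let $n\ge1$, let $\ell_1,\ldots,\ell_n$ be integers with $\ell_i>1$, let $\circ\in\{\text{"$,$"},\text{"$+$"}\}$, and let $\mathbf L=(2,\ell_1,\ldots,\ell_n)$ if $\circ$ is "$,$" and $\mathbf L=(2+\ell_1,\ell_2,\ldots,\ell_n)$ if $\circ$ is "$+$". Suppose that $\mathrm{bl}^{ -1}(\mathbf L)$ is the word $0\,10^{s_1-1}\,10^{s_2-1}\cdots10^{s_{n'}-1}\,1$ of some index $\vec s=(s_1,\ldots,s_{n'})$ of positive integers. Then \[ \vec s^{(1)}=(\widetilde{\ell_1},\ldots,\widetilde{\ell_n}),\qquad\text{where } \widetilde{\ell_i}=\ell_i \text{ if } \ell_i \text{ is odd and } \widetilde{\ell_i}=\overline{\ell_i}\text{ if } \ell_i \text{ is even}. \]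
   Context: An alternating word is a nonempty word in $\{0,1\}$ with no two equal consecutive letters. For positive integers $(L_1,\ldots,L_m)$, $\mathrm{bl}^{ -1}(L_1,\ldots,L_m)$ is the unique word $w_1\cdots w_m$ starting with $0$, where each $w_i$ is an alternating word of length $L_i$ and the last letter of $w_i$ equals the first letter of $w_{i+1}$ for $i<m$. (Under the hypotheses, the index $\vec s$ has all entries in $\{1,2,3\}$.) Signed integers: a signed integer is either a positive integer $k$ or a barred integer $\overline{k}$ ($k\ge1$); write $|k|=|\overline k|=k$, with sign $+1$ for $k$ and $-1$ for $\overline k$. For signed integers $a,b$, $a\oplus b$ is the signed integer with absolute value $|a|+|b|$ and sign the product of the signs of $a$ and $b$ (e.g. $\overline{a}\oplus 2=\overline{a+2}$, $\overline a\oplus\overline 1=a+1$, $a\oplus\overline1=\overline{a+1}$). For a sequence $(t_1,\ldots,t_k)$ of signed integers and a signed integer $u$, $(t_1,\ldots,t_k)\oplus u:=(t_1,\ldots,t_{k-1},t_k\oplus u)$. Zhao's sequence $\vec s^{(1)}$ (in the convention used here) for an index $\vec s=(s_1,\ldots,s_m)$ with entries in $\{1,2,3\}$ is defined recursively: for $m=1$, $(1)^{(1)}=(1)$, $(2)^{(1)}=(\overline2)$, $(3)^{(1)}=(1,\overline2)$; and if $(s_1,\ldots,s_m)^{(1)}=\vec t$, then $(s_1,\ldots,s_m,s_{m+1})^{(1)}$ equals $(\vec t,1)$ if $s_{m+1}=1$, equals $\vec t\oplus 2$ if $s_{m+1}=2$, and equals $(\vec t\oplus\overline1,\overline2)$ if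 $s_{m+1}=3$. -}

module Defs where

open import Data.Nat using (ℕ; zero; suc; _+_; _∸_)
open import Data.Bool using (Bool; true; false)
open import Data.List using (List; []; _∷_; _++_; replicate; concatMap; map)
open import Data.Maybe using (Maybe; just; nothing)

data Bit : Set where
  b0 b1 : Bit

flipBit : Bit → Bit
flipBit b0 = b1
flipBit b1 = b0

isOdd : ℕ → Bool
isOdd zero = false
isOdd (suc zero) = true
isOdd (suc (suc n)) = isOdd n

alt : Bit → ℕ → List Bit
alt b zero = []
alt b (suc k) = b ∷ alt (flipBit b) k

altLast : Bit → ℕ → Bit
altLast b zero = b
altLast b (suc zero) = b
altLast b (suc (suc k)) = altLast (flipBit b) (suc k)

blFrom : Bit → List ℕ → List Bit
blFrom b [] = []
blFrom b (L ∷ Ls) = alt b L ++ blFrom (altLast b L) Ls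

blInv : List ℕ → List Bit
blInv = blFrom b0

indexWord : List ℕ → List Bit
indexWord s = b0 ∷ (concatMap (λ k → b1 ∷ replicate (k ∸ 1) b0) s ++ (b1 ∷ []))

-- signed integers: pos k = k, bar k = k̄  (k ≥ 1 in all uses)
data Signed : Set where
  pos bar : ℕ → Signed

_⊕_ : Signed → Signed → Signed
pos a ⊕ pos b = pos (a + b)
pos a ⊕ bar b = bar (a + b)
bar a ⊕ pos b = bar (a + b)
bar a ⊕ bar b = pos (a + b)

-- (t_1,…,t_k) ⊕ u = (t_1,…,t_{k-1}, t_k ⊕ u)  (the empty case never arises)
_⊕ₗ_ : List Signed → Signed → List Signed
[] ⊕ₗ u = []
(t ∷ []) ⊕ₗ u = (t ⊕ u) ∷ []
(t ∷ t' ∷ ts) ⊕ₗ u = t ∷ ((t' ∷ ts) ⊕ₗ u)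

-- Zhao's sequence s^{(1)}; defined (just) exactly when s is nonempty with
-- entries in {1,2,3}, otherwise nothing.
zhaoStart : ℕ → Maybe (List Signed)
zhaoStart 1 = just (pos 1 ∷ [])
zhaoStart 2 = just (bar 2 ∷ [])
zhaoStart 3 = just (pos 1 ∷ bar 2 ∷ [])
zhaoStart _ = nothing

zhaoStep : List Signed → ℕ → Maybe (List Signed)
zhaoStep t 1 = just (t ++ (pos 1 ∷ []))
zhaoStep t 2 = just (t ⊕ₗ pos 2)
zhaoStep t 3 = just ((t ⊕ₗ bar 1) ++ (bar 2 ∷ []))
zhaoStep t _ = nothing

zhaoGo : List Signed → List ℕ → Maybe (List Signed)
zhaoGo t [] = just t
zhaoGo t (s ∷ ss) with zhaoStep t s
... | nothing = nothing
... | just t' = zhaoGo t' ss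

zhao : List ℕ → Maybe (List Signed)
zhao [] = nothing
zhao (s ∷ ss) with zhaoStart s
... | nothing = nothing
... | just t = zhaoGo t ss

tilde : ℕ → Signed
tilde l with isOdd l
... | true = pos l
... | false = bar l

data Op : Set where
  comma plus : Op

bigL : Op → ℕ → List ℕ → List ℕ
bigL comma l ls = 2 ∷ l ∷ ls
bigL plus l ls = (2 + l) ∷ ls

{-# OPTIONS --safe #-}
-- Read bl⁻¹(𝐋) from its second letter on, one gap 1 0^{a-1} at a time. Inside a block of
-- length ℓ the word alternates, so each gap is 2 and adds 2 to the last entry of Zhao's
-- sequence; at a block boundary the repeated letter is either a 1 (gap 1, which opens a
-- new entry) or a 0 (gap 3, which adds 1̄ to the last entry and opens a new one at 2̄).
-- Throughout, the last entry is k̃ for the k letters of the current block read so far: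
-- ⊕ 2 keeps and ⊕ 1̄ flips the sign, just as adding 2 or 1 keeps or flips the parity.
module Submission where

open import Defs
open import Data.Nat using (ℕ; _<_; _≤_; zero; suc; _+_; _∸_; s≤s; z≤n)
open import Data.Nat.Properties using (+-identityʳ; +-assoc)
open import Data.Bool using (Bool; true; false; not)
open import Data.List using (List; _∷_; []; map; _++_; _∷ʳ_; replicate; concatMap)
open import Data.List.Properties using (++-assoc; ∷-injectiveʳ)
open import Data.List.Relation.Unary.All using (All; []; _∷_)
open import Data.Maybe using (just)
open import Data.Product using (_×_; _,_; ∃; ∃₂)
open import Data.Empty using (⊥-elim)
open import Relation.Binary.PropositionalEquality
open ≡-Reasoning

signed : Bool → ℕ → Signed
signed true  = pos
signed false = bar

tilde-signed : ∀ k → tilde k ≡ signed (isOdd k) k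
tilde-signed k with isOdd k
... | true  = refl
... | false = refl

signed-⊕-pos : ∀ b m n → signed b m ⊕ pos n ≡ signed b (m + n)
signed-⊕-pos true  m n = refl
signed-⊕-pos false m n = refl

signed-⊕-bar : ∀ b m n → signed b m ⊕ bar n ≡ signed (not b) (m + n)
signed-⊕-bar true  m n = refl
signed-⊕-bar false m n = refl

isOdd-+1 : ∀ k → isOdd (k + 1) ≡ not (isOdd k)
isOdd-+1 zero          = refl
isOdd-+1 (suc zero)    = refl
isOdd-+1 (suc (suc k)) = isOdd-+1 k

isOdd-+2 : ∀ k → isOdd (k + 2) ≡ isOdd k
isOdd-+2 zero          = refl
isOdd-+2 (suc zero)    = refl
isOdd-+2 (suc (suc k)) = isOdd-+2 k

tilde-⊕-pos2 : ∀ k → tilde k ⊕ pos 2 ≡ tilde (k + 2)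
tilde-⊕-pos2 k = begin
  tilde k ⊕ pos 2                 ≡⟨ cong (_⊕ pos 2) (tilde-signed k) ⟩
  signed (isOdd k) k ⊕ pos 2      ≡⟨ signed-⊕-pos (isOdd k) k 2 ⟩
  signed (isOdd k) (k + 2)        ≡⟨ cong (λ b → signed b (k + 2)) (sym (isOdd-+2 k)) ⟩
  signed (isOdd (k + 2)) (k + 2)  ≡⟨ sym (tilde-signed (k + 2)) ⟩
  tilde (k + 2)                   ∎

tilde-⊕-bar1 : ∀ k → tilde k ⊕ bar 1 ≡ tilde (k + 1)
tilde-⊕-bar1 k = begin
  tilde k ⊕ bar 1                 ≡⟨ cong (_⊕ bar 1) (tilde-signed k) ⟩
  signed (isOdd k) k ⊕ bar 1      ≡⟨ signed-⊕-bar (isOdd k) k 1 ⟩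
  signed (not (isOdd k)) (k + 1)  ≡⟨ cong (λ b → signed b (k + 1)) (sym (isOdd-+1 k)) ⟩
  signed (isOdd (k + 1)) (k + 1)  ≡⟨ sym (tilde-signed (k + 1)) ⟩
  tilde (k + 1)                   ∎

∷ʳ-⊕ₗ : ∀ t x u → (t ∷ʳ x) ⊕ₗ u ≡ t ∷ʳ (x ⊕ u)
∷ʳ-⊕ₗ []          x u = refl
∷ʳ-⊕ₗ (a ∷ [])    x u = refl
∷ʳ-⊕ₗ (a ∷ b ∷ t) x u = cong (a ∷_) (∷ʳ-⊕ₗ (b ∷ t) x u)

indexTail : List ℕ → List Bit
indexTail s = concatMap (λ k → b1 ∷ replicate (k ∸ 1) b0) s ++ b1 ∷ []

indexTail-∷ : ∀ a s → ∃ λ xs →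
  indexTail s ≡ b1 ∷ xs × indexTail (suc a ∷ s) ≡ b1 ∷ replicate a b0 ++ b1 ∷ xs
indexTail-∷ a []      = _ , refl , cong (b1 ∷_) (++-assoc (replicate a b0) _ (b1 ∷ []))
indexTail-∷ a (_ ∷ _) = _ , refl , cong (b1 ∷_) (++-assoc (replicate a b0) _ (b1 ∷ []))

replicate-b0-cancel : ∀ a c {xs ys} →
  replicate a b0 ++ b1 ∷ xs ≡ replicate c b0 ++ b1 ∷ ys → a ≡ c × xs ≡ ys
replicate-b0-cancel zero    zero    refl = refl , refl
replicate-b0-cancel (suc a) (suc c) eq
  with refl , xs≡ys ← replicate-b0-cancel a c (∷-injectiveʳ eq) = refl , xs≡ys

replicate-b0-++-b1 : ∀ a c {xs} → replicate a b0 ++ b1 ∷ xs ≢ replicate c b0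
replicate-b0-++-b1 zero    zero    ()
replicate-b0-++-b1 zero    (suc c) ()
replicate-b0-++-b1 (suc a) zero    ()
replicate-b0-++-b1 (suc a) (suc c) eq = replicate-b0-++-b1 a c (∷-injectiveʳ eq)

indexTail-uncons : ∀ a c s {ys} →
  indexTail (suc a ∷ s) ≡ b1 ∷ replicate c b0 ++ b1 ∷ ys → a ≡ c × indexTail s ≡ b1 ∷ ys
indexTail-uncons a c s eq with xs , s≡ , as≡ ← indexTail-∷ a s
  with refl , xs≡ys ← replicate-b0-cancel a c (∷-injectiveʳ (trans (sym as≡) eq))
  = refl , trans s≡ (cong (b1 ∷_) xs≡ys)

indexTail-∷-≢ : ∀ a c s → indexTail (suc a ∷ s) ≢ b1 ∷ replicate c b0
indexTail-∷-≢ a c s eq with xs , s≡ , as≡ ← indexTail-∷ a s =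
  replicate-b0-++-b1 a c (∷-injectiveʳ (trans (sym as≡) eq))

-- Gap m ls a m′ ls′: from a 1 followed by m more letters of the current block and then
-- the blocks ls, the next gap is a and leads to the state (m′, ls′).
data Gap : ℕ → List ℕ → ℕ → ℕ → List ℕ → Set where
  within  : ∀ {m ls} → Gap (suc (suc m)) ls 2 m ls
  across₀ : ∀ {j ls} → Gap zero (suc (suc j) ∷ ls) 1 (suc j) ls
  across₁ : ∀ {j ls} → Gap 1 (suc (suc j) ∷ ls) 3 j ls

indexTail-[] : ∀ {m ls} → All (1 <_) ls → indexTail [] ≡ blFrom b1 (suc m ∷ ls) → m ≡ 0 × ls ≡ []
indexTail-[] {zero}  {[]}    _                     refl = refl , refl
indexTail-[] {zero}  {_ ∷ _} (s≤s (s≤s z≤n) ∷ _)   ()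
indexTail-[] {suc m}         _                     ()

indexTail-gap : ∀ {a m ls} s → All (1 <_) ls → 1 ≤ a → indexTail (a ∷ s) ≡ blFrom b1 (suc m ∷ ls) →
  ∃₂ λ m′ ls′ → Gap m ls a m′ ls′ × All (1 <_) ls′ × indexTail s ≡ blFrom b1 (suc m′ ∷ ls′)
indexTail-gap {suc a} {suc (suc m)} s als _ eq
  with refl , eq′ ← indexTail-uncons a 1 s eq = _ , _ , within , als , eq′
indexTail-gap {suc a} {suc zero} {[]} s _ _ eq = ⊥-elim (indexTail-∷-≢ a 1 s eq)
indexTail-gap {suc a} {suc zero} {_ ∷ _} s (s≤s (s≤s z≤n) ∷ als) _ eq
  with refl , eq′ ← indexTail-uncons a 2 s eq = _ , _ , across₁ , als , eq′
indexTail-gap {suc a} {zero} {[]} s _ _ eq = ⊥-elim (indexTail-∷-≢ a 0 s eq)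
indexTail-gap {suc a} {zero} {_ ∷ _} s (s≤s (s≤s z≤n) ∷ als) _ eq
  with refl , eq′ ← indexTail-uncons a 0 s eq = _ , _ , across₀ , als , eq′

zhaoGo-indexTail : ∀ t k m {ls} s → All (1 <_) ls → All (1 ≤_) s → indexTail s ≡ blFrom b1 (suc m ∷ ls) →
  zhaoGo (t ∷ʳ tilde k) s ≡ just (t ++ tilde (k + m) ∷ map tilde ls)
zhaoGo-indexTail t k m [] als [] eq with refl , refl ← indexTail-[] als eq =
  cong (λ n → just (t ∷ʳ tilde n)) (sym (+-identityʳ k))
zhaoGo-indexTail t k m (_ ∷ s) als (a≥1 ∷ as) eq with indexTail-gap s als a≥1 eq
... | m′ , ls , within , als′ , eq′ = begin
  zhaoGo ((t ∷ʳ tilde k) ⊕ₗ pos 2) s               ≡⟨ cong (λ u → zhaoGo u s) (∷ʳ-⊕ₗ t (tilde k) (pos 2)) ⟩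
  zhaoGo (t ∷ʳ (tilde k ⊕ pos 2)) s                ≡⟨ cong (λ x → zhaoGo (t ∷ʳ x) s) (tilde-⊕-pos2 k) ⟩
  zhaoGo (t ∷ʳ tilde (k + 2)) s                    ≡⟨ zhaoGo-indexTail t (k + 2) m′ s als′ as eq′ ⟩
  just (t ++ tilde (k + 2 + m′) ∷ map tilde ls)    ≡⟨ cong (λ n → just (t ++ tilde n ∷ map tilde ls)) (+-assoc k 2 m′) ⟩
  just (t ++ tilde (k + (2 + m′)) ∷ map tilde ls)  ∎
... | j , ls , across₁ , als′ , eq′ = begin
  zhaoGo (((t ∷ʳ tilde k) ⊕ₗ bar 1) ∷ʳ bar 2) s                ≡⟨ cong (λ u → zhaoGo (u ∷ʳ bar 2) s) (∷ʳ-⊕ₗ t (tilde k) (bar 1)) ⟩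
  zhaoGo ((t ∷ʳ (tilde k ⊕ bar 1)) ∷ʳ bar 2) s                 ≡⟨ cong (λ x → zhaoGo ((t ∷ʳ x) ∷ʳ bar 2) s) (tilde-⊕-bar1 k) ⟩
  zhaoGo ((t ∷ʳ tilde (k + 1)) ∷ʳ tilde 2) s                   ≡⟨ zhaoGo-indexTail (t ∷ʳ tilde (k + 1)) 2 j s als′ as eq′ ⟩
  just ((t ∷ʳ tilde (k + 1)) ++ tilde (2 + j) ∷ map tilde ls)  ≡⟨ cong just (++-assoc t _ _) ⟩
  just (t ++ tilde (k + 1) ∷ tilde (2 + j) ∷ map tilde ls)     ∎
... | m′ , ls , across₀ , als′ , eq′ = begin
  zhaoGo ((t ∷ʳ tilde k) ∷ʳ tilde 1) s                     ≡⟨ zhaoGo-indexTail (t ∷ʳ tilde k) 1 m′ s als′ as eq′ ⟩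
  just ((t ∷ʳ tilde k) ++ tilde (1 + m′) ∷ map tilde ls)   ≡⟨ cong just (++-assoc t _ _) ⟩
  just (t ++ tilde k ∷ tilde (1 + m′) ∷ map tilde ls)      ≡⟨ cong (λ n → just (t ++ tilde n ∷ _)) (sym (+-identityʳ k)) ⟩
  just (t ++ tilde (k + 0) ∷ tilde (1 + m′) ∷ map tilde ls) ∎

mainTheorem2 : (l : ℕ) (ls : List ℕ) → All (1 <_) (l ∷ ls) → (o : Op) →
    (s : List ℕ) → All (1 ≤_) s → blInv (bigL o l ls) ≡ indexWord s →
    zhao s ≡ just (map tilde (l ∷ ls))
-- Definitionally bl⁻¹(2, ℓ, …) = 0 · blFrom 1 (1, ℓ, …) and bl⁻¹(2 + ℓ, …) = 0 · blFrom 1 (ℓ + 1, …).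
mainTheorem2 (suc (suc j)) ls (s≤s (s≤s z≤n) ∷ _) comma [] _ ()
mainTheorem2 (suc (suc j)) ls als@(s≤s (s≤s z≤n) ∷ _) comma (_ ∷ s) (a≥1 ∷ as) eq
  with _ , _ , across₀ , als′ , eq′ ← indexTail-gap {m = 0} s als a≥1 (sym (∷-injectiveʳ eq))
  = zhaoGo-indexTail [] 1 (suc j) s als′ as eq′
mainTheorem2 (suc (suc j)) ls (s≤s (s≤s z≤n) ∷ _) plus [] _ ()
mainTheorem2 (suc (suc j)) ls (s≤s (s≤s z≤n) ∷ als) plus (_ ∷ s) (a≥1 ∷ as) eq
  with _ , _ , within , als′ , eq′ ← indexTail-gap {m = suc (suc j)} s als a≥1 (sym (∷-injectiveʳ eq))
  = zhaoGo-indexTail [] 2 j s als′ as eq′
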